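{- For each Kripke model $\mathfrak M=\langle\mathfrak F,V\rangle$, set of formulas $\Gamma$, and formula $\gamma$: $\|\bigwedge\Gamma\|_{\mathfrak M}\subseteq\Box_{\mathfrak F}\big(\|\bigwedge i_\gamma(\Gamma)\|_{\mathfrak M}\cup\Diamond^{ -1}_{\mathfrak F}\|\gamma\|_{\mathfrak M}\big)$.
   Context: Formulas are built from propositional letters and $\bot$ using $\land,\lor,\to$. For a frame $\mathfrak F=\langle W,R\rangle$, $X\subseteq W$: $\Box_{\mathfrak F}X=\{w\mid\forall v(wRv\Rightarrow v\in X)\}$, $\Diamond^{ -1}_{\mathfrak F}X=\{w\mid\exists x\in X,\ xRw\}$. Truth sets: $\|p\|=V(p)$, $\|\bot\|=\Box_{\mathfrak F}\emptyset$, $\|\alpha\land\beta\|=\|\alpha\|\cap\|\beta\|$, $\|\alpha\to\beta\|=\Box_{\mathfrak F}((W\setminus\|\alpha\|)\cup\|\beta\|)$, $\|\alpha\lor\beta\|=\Box_{\mathfrak F}\Diamond^{ -1}_{\mathfrak F}(\|\alpha\|\cup\|\beta\|)$. $\|\bigwedge\Gamma\|$ denotes $\bigcap\{\|\alpha\|\mid\alpha\in\Gamma\}$. An i-formula is $\Delta\sqsupset\Theta$ ($\Delta,\Theta$ non-empty finite sets of formulas) with $\|\Delta\sqsupset\Theta\|=(W\setminus\|\bigwedge\Delta\|)\cup\|\bigvee\Theta\|$, and for a set of i-formulas $\|\bigwedge\Gamma^i\|=\bigcap\{\|\alpha^i\|\mid\alpha^i\in\Gamma^i\}$. $i_\gamma(\Gamma)=\{\{\varphi_1,\dots,\varphi_n\}\sqsupset\{\psi_1,\dots,\psi_n\}\mid\bigvee_j(\varphi_j\to\psi_j)\lor\gamma\in\Gamma\}$.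 -}

module Defs where

open import Data.Nat using (ℕ)
open import Data.Product using (Σ; _×_; _,_; proj₁; proj₂; ∃-syntax)
open import Data.Sum using (_⊎_)
open import Data.Empty using (⊥)
open import Relation.Nullary using (¬_)
open import Relation.Binary.PropositionalEquality using (_≡_)
open import Data.List.NonEmpty using (List⁺; foldr₁; toList)
import Data.List.NonEmpty as L⁺
open import Data.List.Relation.Unary.All using (All)

data Formula : Set where
  var  : ℕ → Formula
  bot  : Formula
  _∧′_ : Formula → Formula → Formula
  _∨′_ : Formula → Formula → Formula
  _⇒_  : Formula → Formula → Formula

infixr 6 _∧′_
infixr 5 _∨′_
infixr 4 _⇒_

record Frame : Set₁ where
  field
    W : Set
    R : W → W → Set

record Model : Set₁ where
  field
    F : Frame
    V : ℕ → Frame.W F → Set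
  open Frame F public

Pred : Set → Set₁
Pred W = W → Set

module _ (F : Frame) where
  open Frame F

  _⊆_ : Pred W → Pred W → Set
  X ⊆ Y = ∀ w → X w → Y w

  _∪_ : Pred W → Pred W → Pred W
  (X ∪ Y) w = X w ⊎ Y w

  _∩_ : Pred W → Pred W → Pred W
  (X ∩ Y) w = X w × Y w

  ∁ : Pred W → Pred W
  ∁ X w = ¬ X w

  ∅ : Pred W
  ∅ _ = ⊥

  □ : Pred W → Pred W
  □ X w = ∀ v → R w v → X v

  ◇⁻¹ : Pred W → Pred W
  ◇⁻¹ X w = ∃[ x ] (X x × R x w)

module _ (M : Model) where
  open Model M

  ‖_‖ : Formula → Pred W
  ‖ var p ‖ = V p
  ‖ bot ‖ = □ F (∅ F)
  ‖ α ∧′ β ‖ = _∩_ F ‖ α ‖ ‖ β ‖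
  ‖ α ⇒ β ‖ = □ F (_∪_ F (∁ F ‖ α ‖) ‖ β ‖)
  ‖ α ∨′ β ‖ = □ F (◇⁻¹ F (_∪_ F ‖ α ‖ ‖ β ‖))

  ‖⋀_‖ : (Formula → Set) → Pred W
  ‖⋀ Γ ‖ w = ∀ α → Γ α → ‖ α ‖ w

⋁ : List⁺ Formula → Formula
⋁ = foldr₁ _∨′_

record IFormula : Set where
  constructor _⊐_
  field
    Δ : List⁺ Formula
    Θ : List⁺ Formula

module _ (M : Model) where
  open Model M

  ‖_‖ⁱ : IFormula → Pred W
  ‖ Δ ⊐ Θ ‖ⁱ w = ¬ All (λ φ → ‖ M ‖ φ w) (toList Δ) ⊎ ‖ M ‖ (⋁ Θ) w

  ‖⋀_‖ⁱ : (IFormula → Set) → Pred W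
  ‖⋀ Γⁱ ‖ⁱ w = ∀ a → Γⁱ a → ‖ a ‖ⁱ w

-- i_γ(Γ) = { {φ₁,…,φₙ} ⊐ {ψ₁,…,ψₙ} | ⋁ⱼ (φⱼ → ψⱼ) ∨ γ ∈ Γ }
-- (the n pairs (φⱼ,ψⱼ) are given as a non-empty list)
i[_] : Formula → (Formula → Set) → IFormula → Set
i[ γ ] Γ a = Σ (List⁺ (Formula × Formula)) λ ps →
    (a ≡ (L⁺.map proj₁ ps ⊐ L⁺.map proj₂ ps)) ×
    Γ (⋁ (L⁺.map (λ p → proj₁ p ⇒ proj₂ p) ps) ∨′ γ)

{-# OPTIONS --safe #-}
module Submission where

open import Defs
open import Level using (0ℓ)
open import Axiom.ExcludedMiddle using (ExcludedMiddle)
open import Data.Product using (_×_; _,_; proj₁; proj₂; uncurry)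
open import Data.Sum using (_⊎_; inj₁; inj₂)
open import Data.List using (List; []; _∷_)
import Data.List as List
open import Data.List.NonEmpty using (List⁺; _∷_; _∷⁺_; map)
open import Data.List.Relation.Unary.All using (_∷_)
open import Function using (_∘_)
open import Relation.Nullary using (¬_; yes; no; contradiction)
open import Relation.Binary.PropositionalEquality using (refl)

-- If v is a successor of w ∈ ‖⋀Γ‖, either v has a γ-predecessor (the one
-- classical case split), or every ⋁ⱼ(φⱼ → ψⱼ) ∨ γ ∈ Γ, being true at w, gives v
-- a predecessor satisfying some φⱼ → ψⱼ.  Since ◇⁻¹ □ X ⊆ X, v then refutes φⱼ
-- or satisfies ψⱼ, and since X ⊆ □ ◇⁻¹ X, disjunctions are still introduced
-- pointwise, so v satisfies {φ₁,…,φₙ} ⊐ {ψ₁,…,ψₙ}.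

module _ (F : Frame) where
  open Frame F

  ◇⁻¹-□-counit : {X : Pred W} {v : W} → ◇⁻¹ F (□ F X) v → X v
  ◇⁻¹-□-counit (x , □X , xRv) = □X _ xRv

  □-◇⁻¹-unit : {X : Pred W} {w : W} → X w → □ F (◇⁻¹ F X) w
  □-◇⁻¹-unit {w = w} Xw u wRu = w , Xw , wRu

  ◇⁻¹-∪ : {X Y : Pred W} {v : W} →
          ◇⁻¹ F (_∪_ F X Y) v → ◇⁻¹ F X v ⊎ ◇⁻¹ F Y v
  ◇⁻¹-∪ (x , inj₁ Xx , xRv) = inj₁ (x , Xx , xRv)
  ◇⁻¹-∪ (x , inj₂ Yx , xRv) = inj₂ (x , Yx , xRv)

module _ {M : Model} where
  open Model M

  ∨-introˡ : ∀ α β {w} → ‖ M ‖ α w → ‖ M ‖ (α ∨′ β) w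
  ∨-introˡ α β = □-◇⁻¹-unit F {X = _∪_ F (‖ M ‖ α) (‖ M ‖ β)} ∘ inj₁

  ∨-introʳ : ∀ α β {w} → ‖ M ‖ β w → ‖ M ‖ (α ∨′ β) w
  ∨-introʳ α β = □-◇⁻¹-unit F {X = _∪_ F (‖ M ‖ α) (‖ M ‖ β)} ∘ inj₂

  ◇⁻¹-⇒ : ∀ φ ψ {v} → ◇⁻¹ F (‖ M ‖ (φ ⇒ ψ)) v → ¬ ‖ M ‖ φ v ⊎ ‖ M ‖ ψ v
  ◇⁻¹-⇒ φ ψ = ◇⁻¹-□-counit F

  ◇⁻¹-∨ : ∀ α β {v} → ◇⁻¹ F (‖ M ‖ (α ∨′ β)) v →
          ◇⁻¹ F (‖ M ‖ α) v ⊎ ◇⁻¹ F (‖ M ‖ β) v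
  ◇⁻¹-∨ α β = ◇⁻¹-∪ F ∘ ◇⁻¹-□-counit F

  ⋁-introʰ : ∀ ψ (Θ : List Formula) {w} → ‖ M ‖ ψ w → ‖ M ‖ (⋁ (ψ ∷ Θ)) w
  ⋁-introʰ ψ []      ψw = ψw
  ⋁-introʰ ψ (θ ∷ Θ) ψw = ∨-introˡ ψ (⋁ (θ ∷ Θ)) ψw

  ⊐-head : ∀ φ ψ (Δ Θ : List Formula) {v} → ¬ ‖ M ‖ φ v ⊎ ‖ M ‖ ψ v →
           ‖ M ‖ⁱ ((φ ∷ Δ) ⊐ (ψ ∷ Θ)) v
  ⊐-head φ ψ Δ Θ (inj₁ ¬φv) = inj₁ λ { (φv ∷ _) → ¬φv φv }
  ⊐-head φ ψ Δ Θ (inj₂ ψv)  = inj₂ (⋁-introʰ ψ Θ ψv)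

  ⊐-tail : ∀ φ ψ (Δ Θ : List⁺ Formula) {v} →
           ‖ M ‖ⁱ (Δ ⊐ Θ) v → ‖ M ‖ⁱ ((φ ∷⁺ Δ) ⊐ (ψ ∷⁺ Θ)) v
  ⊐-tail φ ψ Δ Θ (inj₁ ¬Δv) = inj₁ λ { (_ ∷ Δv) → ¬Δv Δv }
  ⊐-tail φ ψ Δ Θ (inj₂ Θv)  = inj₂ (∨-introʳ ψ (⋁ Θ) Θv)

  ◇⁻¹-⋁⇒-⊐ : ∀ p (qs : List (Formula × Formula)) {v} →
             ◇⁻¹ F (‖ M ‖ (⋁ (map (uncurry _⇒_) (p ∷ qs)))) v →
             ‖ M ‖ⁱ (map proj₁ (p ∷ qs) ⊐ map proj₂ (p ∷ qs)) v
  ◇⁻¹-⋁⇒-⊐ (φ , ψ) [] pred = ⊐-head φ ψ [] [] (◇⁻¹-⇒ φ ψ pred)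
  ◇⁻¹-⋁⇒-⊐ (φ , ψ) (q ∷ qs) pred
    with ◇⁻¹-∨ (φ ⇒ ψ) (⋁ (map (uncurry _⇒_) (q ∷ qs))) pred
  ... | inj₁ pred-φ⇒ψ =
    ⊐-head φ ψ (List.map proj₁ (q ∷ qs)) (List.map proj₂ (q ∷ qs)) (◇⁻¹-⇒ φ ψ pred-φ⇒ψ)
  ... | inj₂ pred-rest =
    ⊐-tail φ ψ (map proj₁ (q ∷ qs)) (map proj₂ (q ∷ qs)) (◇⁻¹-⋁⇒-⊐ q qs pred-rest)

lemma11 : ExcludedMiddle 0ℓ →
    (M : Model) (Γ : Formula → Set) (γ : Formula) →
    _⊆_ (Model.F M) (‖⋀_‖ M Γ)
    (□ (Model.F M) (_∪_ (Model.F M) (‖⋀_‖ⁱ M (i[ γ ] Γ)) (◇⁻¹ (Model.F M) (‖_‖ M γ))))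
lemma11 em M Γ γ w Γw v wRv with em {◇⁻¹ (Model.F M) (‖ M ‖ γ) v}
... | yes γ-pred = inj₂ γ-pred
... | no ¬γ-pred = inj₁ i[γ]Γ-holds
  where
  i[γ]Γ-holds : ‖⋀_‖ⁱ M (i[ γ ] Γ) v
  i[γ]Γ-holds _ ((p ∷ qs) , refl , ∈Γ)
    with ◇⁻¹-∨ {M} (⋁ (map (uncurry _⇒_) (p ∷ qs))) γ (w , Γw _ ∈Γ , wRv)
  ... | inj₁ pred-⋁ = ◇⁻¹-⋁⇒-⊐ p qs pred-⋁
  ... | inj₂ γ-pred = contradiction γ-pred ¬γ-pred
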